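{- Let $G$ be an $\alpha$-weakly-Helly graph and $H=\mathcal{H}(G)$ its injective hull. For any $M\subseteq V(G)$ and any integer $\ell\ge 0$, $C_G^{\ell}(M)\subseteq D_H(C_H(M),\alpha+\ell)=D_H(C_H^{\ell}(M),\alpha)$.
   Context: All graphs are finite, simple, undirected, unweighted and connected. A graph $G$ is $\alpha$-weakly-Helly if for every family of pairwise intersecting disks $\{D_G(v,r(v)) : v\in S\}$ (where $D_G(v,r)=\{u: d_G(u,v)\le r\}$) the disks $D_G(v,r(v)+\alpha)$, $v\in S$, have a common vertex; Helly graphs are the $0$-weakly-Helly graphs. The injective hull $\mathcal{H}(G)$ is the unique minimal Helly graph containing $G$ as an isometric subgraph; $V(G)$ is identified with its image. For $X\in\{G,H\}$: $e_X^M(v)=\max_{u\in M}d_X(v,u)$, $rad_X(M)=\min_{v\in V(X)}e_X^M(v)$, $C_X^{\ell}(M)=\{v\in V(X): e_X^M(v)\le rad_X(M)+\ell\}$, $C_X(M)=C_X^0(M)$, and for $S\subseteq V(X)$, $D_X(S,k)=\{u\in V(X): \min_{s\in S}d_X(u,s)\le k\}$. -}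

module Defs where

open import Data.Nat using (ℕ; zero; suc; _+_; _≤_; _⊔_; _⊓_)
open import Data.Bool using (Bool; true; false; _∧_; _∨_; if_then_else_)
open import Data.Fin using (Fin; zero; suc)
open import Data.Fin.Subset using (Subset; _∈_)
open import Data.List using (List; map; foldr)
open import Data.Bool.ListAction using (any)
open import Data.List.Base using (allFin)
open import Data.Vec using (lookup)
open import Data.Product using (Σ; ∃; _×_; _,_)
open import Relation.Binary.PropositionalEquality using (_≡_)
open import Relation.Nullary.Decidable using (⌊_⌋)
import Data.Fin.Properties as FinP
open import Function.Definitions using (Surjective)

ballB : {n : ℕ} → (Fin n → Fin n → Bool) → ℕ → Fin n → Fin n → Bool
ballB {n} a zero    u v = ⌊ u FinP.≟ v ⌋
ballB {n} a (suc k) u v =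
  ballB a k u v ∨ any (λ w → ballB a k u w ∧ a w v) (allFin n)

record Graph : Set where
  field
    N         : ℕ
    adj       : Fin (suc N) → Fin (suc N) → Bool
    adj-sym   : ∀ u v → adj u v ≡ adj v u
    adj-irr   : ∀ u → adj u u ≡ false
    connected : ∀ u v → ballB adj N u v ≡ true

  V : Set
  V = Fin (suc N)

open Graph public

firstTrue : (ℕ → Bool) → ℕ → ℕ → ℕ
firstTrue f i zero       = i
firstTrue f i (suc fuel) = if f i then i else firstTrue f (suc i) fuel

-- shortest-path distance d_G(u,v) (graph is connected, so d < suc N)
dist : (G : Graph) → V G → V G → ℕ
dist G u v = firstTrue (λ k → ballB (adj G) k u v) 0 (N G)

Disk : (G : Graph) → V G → ℕ → V G → Set
Disk G v r u = dist G u v ≤ r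

WeaklyHelly : ℕ → Graph → Set
WeaklyHelly α G =
  (S : Subset (suc (N G))) (r : V G → ℕ) →
  (∀ u v → u ∈ S → v ∈ S → ∃ λ x → Disk G u (r u) x × Disk G v (r v) x) →
  ∃ λ x → ∀ v → v ∈ S → Disk G v (r v + α) x

Helly : Graph → Set
Helly G = WeaklyHelly 0 G

IsometricEmbedding : (G H : Graph) → (V G → V H) → Set
IsometricEmbedding G H φ = ∀ u v → dist H (φ u) (φ v) ≡ dist G u v

-- (H , φ) is the injective hull of G: H is Helly, φ embeds G
-- isometrically into H, and H is minimal: whenever G embeds
-- isometrically into a Helly graph H' which itself embeds isometrically
-- into H compatibly with φ, the embedding H' → H is onto (i.e. no proper
-- isometric Helly subgraph of H contains φ(G)).
IsInjectiveHull : (G H : Graph) → (V G → V H) → Set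
IsInjectiveHull G H φ =
  Helly H × IsometricEmbedding G H φ ×
  ((H' : Graph) (ψ : V G → V H') (χ : V H' → V H) →
    Helly H' → IsometricEmbedding G H' ψ → IsometricEmbedding H' H χ →
    (∀ u → χ (ψ u) ≡ φ u) →
    ∀ y → ∃ λ x → χ x ≡ y)

ecc : (X : Graph) → (V X → Bool) → V X → ℕ
ecc X M v = foldr _⊔_ 0 (map (λ u → if M u then dist X v u else 0) (allFin (suc (N X))))

rad : (X : Graph) → (V X → Bool) → ℕ
rad X M = foldr _⊓_ (ecc X M zero) (map (ecc X M) (allFin (suc (N X))))

Center : (X : Graph) → ℕ → (V X → Bool) → V X → Set
Center X ℓ M v = ecc X M v ≤ rad X M + ℓ

DiskSet : (X : Graph) → (V X → Set) → ℕ → V X → Set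
DiskSet X S k u = ∃ λ s → S s × dist X u s ≤ k

imageSet : (G H : Graph) → (V G → V H) → (V G → Bool) → V H → Bool
imageSet G H φ M y = any (λ u → M u ∧ ⌊ φ u FinP.≟ y ⌋) (allFin (suc (N G)))

module Submission where

-- Everything rests on one use of the (weak) Helly property, `centers-approximate`:
-- in an α-weakly-Helly graph a vertex t of C^k(P) lies within k + α of C^α(P),
-- because the disks D(m, rad P), m ∈ P, and D(t, k) pairwise intersect.  For the
-- Helly graph H (α = 0) this gives `helly-centers`: C^k_H(P) ⊆ D_H(C_H(P), k),
-- which together with the triangle inequality yields the equality of the two
-- neighbourhoods (`helly-center-disks`).  The same Helly argument with equal
-- radii, run in G on M (whose pairwise distances agree with those of φ(M) in H),
-- gives rad_G(M) ≤ rad_H(φ M) + α; as φ preserves eccentricities, C^ℓ_G(M) is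
-- mapped into C^(α+ℓ)_H(φ M) (`center-image`), and `helly-centers` concludes.

open import Defs
open import Data.Nat using (ℕ; zero; suc; _+_; _≤_; _⊓_; z≤n)
open import Data.Nat.Properties
  using ( ≤-refl; ≤-reflexive; ≤-trans; ≤-pred; m≤n⇒m<n∨m≡n; module ≤-Reasoning
        ; +-identityʳ; +-suc; +-comm; +-assoc; +-monoˡ-≤; +-monoʳ-≤
        ; ⊔-lub; m≤n⇒m≤n⊔o; m≤n⇒m≤o⊔n
        ; ⊓-sel; ⊓-glb; m⊓n≤m; m⊓n≤n; m≤n⇒m⊓o≤n; m≤n⇒o⊓m≤n; +-distribʳ-⊓ )
open import Data.Bool using (Bool; true; false; T; _∧_; _∨_; if_then_else_)
open import Data.Bool.Properties using (T-∨; T-∧; T-≡)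
open import Data.Bool.ListAction using (any)
open import Data.Unit using (tt)
open import Data.Empty using (⊥-elim)
open import Data.Fin using (Fin; zero)
open import Data.Fin.Properties using (_≟_)
open import Data.Fin.Subset using (_∈_)
open import Data.Vec using (tabulate)
open import Data.Vec.Properties using (lookup∘tabulate; []=⇒lookup; lookup⇒[]=)
open import Data.List using (map; allFin)
open import Data.List.Properties using (foldr-preservesᵒ; foldr-preservesᵇ)
open import Data.List.Membership.Propositional.Properties using (foldr-selective)
import Data.List.Relation.Unary.Any.Properties as Anyₚ
import Data.List.Relation.Unary.All.Properties as Allₚ
open import Data.Product using (∃; _×_; _,_; map₂)
open import Data.Sum using (_⊎_; inj₁; inj₂; [_,_])
open import Function.Base using (_∘_; id)
open import Function.Bundles using (Equivalence; _⇔_; mk⇔)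
open import Relation.Nullary using (Dec; yes; no)
open import Relation.Nullary.Decidable using (⌊_⌋; toWitness; fromWitness; isYes≗does; dec-true; dec-false)
open import Relation.Binary.PropositionalEquality using (_≡_; _≢_; refl; sym; trans; cong; subst)

any-allFin⁺ : ∀ {n} (f : Fin n → Bool) (i : Fin n) → T (f i) → T (any f (allFin n))
any-allFin⁺ f i fi = Anyₚ.any⁺ f (Anyₚ.tabulate⁺ i fi)

any-allFin⁻ : ∀ {n} (f : Fin n → Bool) → T (any f (allFin n)) → ∃ λ i → T (f i)
any-allFin⁻ f h = Anyₚ.tabulate⁻ (Anyₚ.any⁻ f _ h)

firstTrue-hit : (f : ℕ → Bool) (i fuel : ℕ) → T (f (i + fuel)) → T (f (firstTrue f i fuel))
firstTrue-hit f i zero h = subst (T ∘ f) (+-identityʳ i) h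
firstTrue-hit f i (suc fuel) h with f i in fi
... | true  = subst T (sym fi) tt
... | false = firstTrue-hit f (suc i) fuel (subst (T ∘ f) (+-suc i fuel) h)

firstTrue-least : (f : ℕ → Bool) (i fuel k : ℕ) → i ≤ k → T (f k) → firstTrue f i fuel ≤ k
firstTrue-least f i zero k i≤k h = i≤k
firstTrue-least f i (suc fuel) k i≤k h with f i in fi
... | true  = i≤k
... | false with m≤n⇒m<n∨m≡n i≤k
...   | inj₁ i<k  = firstTrue-least f (suc i) fuel k i<k h
...   | inj₂ refl = ⊥-elim (subst T fi h)

selected : ∀ b {d} → T b → d ≤ (if b then d else 0)
selected true _ = ≤-refl

bounded : ∀ b {d R} → (T b → d ≤ R) → (if b then d else 0) ≤ R
bounded true  h = h tt
bounded false h = z≤n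

module Metric (X : Graph) where

  record Reach (k : ℕ) (u v : V X) : Set where
    constructor reach
    field walk : T (ballB (adj X) k u v)

  reach-refl : ∀ {u} → Reach 0 u u
  reach-refl = reach (fromWitness refl)

  reach-0 : ∀ {u v} → Reach 0 u v → u ≡ v
  reach-0 (reach w) = toWitness w

  reach-suc : ∀ {k u v} → Reach k u v → Reach (suc k) u v
  reach-suc (reach w) = reach (Equivalence.from T-∨ (inj₁ w))

  reach-step : ∀ {k u w v} → Reach k u w → T (adj X w v) → Reach (suc k) u v
  reach-step {k} {u} {w} {v} (reach p) e =
    reach (Equivalence.from (T-∨ {ballB (adj X) k u v}) (inj₂ (any-allFin⁺ (λ x → ballB (adj X) k u x ∧ adj X x v) w
      (Equivalence.from T-∧ (p , e)))))

  reach-last : ∀ {k u v} → Reach (suc k) u v → Reach k u v ⊎ ∃ λ w → Reach k u w × T (adj X w v)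
  reach-last (reach p) with Equivalence.to T-∨ p
  ... | inj₁ q = inj₁ (reach q)
  ... | inj₂ q with any-allFin⁻ _ q
  ...   | w , q' with Equivalence.to T-∧ q'
  ...     | pw , e = inj₂ (w , reach pw , e)

  reach-mono : ∀ {j k u v} → j ≤ k → Reach j u v → Reach k u v
  reach-mono {k = zero}  z≤n r = r
  reach-mono {k = suc k} j≤k r with m≤n⇒m<n∨m≡n j≤k
  ... | inj₁ j<k  = reach-suc (reach-mono (≤-pred j<k) r)
  ... | inj₂ refl = r

  reach-concat : ∀ a b {u w v} → Reach a u w → Reach b w v → Reach (a + b) u v
  reach-concat a zero p q rewrite +-identityʳ a | reach-0 q = p
  reach-concat a (suc b) p q rewrite +-suc a b with reach-last q
  ... | inj₁ q'           = reach-suc (reach-concat a b p q')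
  ... | inj₂ (x , q' , e) = reach-step (reach-concat a b p q') e

  reach-split : ∀ a b {u v} → Reach (a + b) u v → ∃ λ x → Reach a u x × Reach b x v
  reach-split a zero {v = v} p rewrite +-identityʳ a = v , p , reach-refl
  reach-split a (suc b) p rewrite +-suc a b with reach-last p
  ... | inj₁ p' with reach-split a b p'
  ...   | x , p₁ , p₂ = x , p₁ , reach-suc p₂
  reach-split a (suc b) p | inj₂ (w , p' , e) with reach-split a b p'
  ...   | x , p₁ , p₂ = x , p₁ , reach-step p₂ e

  reach-sym : ∀ k {u v} → Reach k u v → Reach k v u
  reach-sym zero p rewrite reach-0 p = reach-refl
  reach-sym (suc k) p with reach-last p
  ... | inj₁ p'           = reach-suc (reach-sym k p')
  ... | inj₂ (w , p' , e) = reach-concat 1 k (reach-step reach-refl (subst T (adj-sym X w _) e)) (reach-sym k p')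

  dist⇒reach : ∀ {u v k} → dist X u v ≤ k → Reach k u v
  dist⇒reach {u} {v} d≤k = reach-mono d≤k
    (reach (firstTrue-hit (λ k → ballB (adj X) k u v) 0 (N X) (Equivalence.from T-≡ (connected X u v))))

  reach⇒dist : ∀ {u v k} → Reach k u v → dist X u v ≤ k
  reach⇒dist {u} {v} {k} (reach w) = firstTrue-least (λ k → ballB (adj X) k u v) 0 (N X) k z≤n w

  dist-self : ∀ {u} → dist X u u ≤ 0
  dist-self = reach⇒dist reach-refl

  dist-sym : ∀ {u v k} → dist X u v ≤ k → dist X v u ≤ k
  dist-sym {k = k} d = reach⇒dist (reach-sym k (dist⇒reach d))

  dist-trans : ∀ {u w v a b} → dist X u w ≤ a → dist X w v ≤ b → dist X u v ≤ a + b
  dist-trans {a = a} {b} d₁ d₂ = reach⇒dist (reach-concat a b (dist⇒reach d₁) (dist⇒reach d₂))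

  dist-split : ∀ a b {u v} → dist X u v ≤ a + b → ∃ λ x → dist X u x ≤ a × dist X x v ≤ b
  dist-split a b d with reach-split a b (dist⇒reach d)
  ... | x , p , q = x , reach⇒dist p , reach⇒dist q

  ecc-≥ : ∀ M v u → T (M u) → dist X v u ≤ ecc X M v
  ecc-≥ M v u u∈M = foldr-preservesᵒ {P = dist X v u ≤_}
    (λ a b → [ m≤n⇒m≤n⊔o b , m≤n⇒m≤o⊔n a ]) 0 _
    (inj₂ (Anyₚ.map⁺ (Anyₚ.tabulate⁺ {f = id} u (selected (M u) u∈M))))

  ecc-≤ : ∀ M v R → (∀ u → T (M u) → dist X v u ≤ R) → ecc X M v ≤ R
  ecc-≤ M v R h = foldr-preservesᵇ {P = _≤ R} ⊔-lub z≤n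
    (Allₚ.map⁺ (Allₚ.tabulate⁺ (λ u → bounded (M u) (h u))))

  rad-≤ : ∀ M v → rad X M ≤ ecc X M v
  rad-≤ M v = foldr-preservesᵒ {P = _≤ ecc X M v}
    (λ a b → [ m≤n⇒m⊓o≤n b , m≤n⇒o⊓m≤n a ]) _ _
    (inj₂ (Anyₚ.map⁺ (Anyₚ.tabulate⁺ {f = id} v ≤-refl)))

  rad-attained : ∀ M → ∃ λ c → ecc X M c ≡ rad X M
  rad-attained M with foldr-selective ⊓-sel (ecc X M zero) (map (ecc X M) (allFin _))
  ... | inj₁ eq  = zero , sym eq
  ... | inj₂ mem with Anyₚ.tabulate⁻ (Anyₚ.map⁻ mem)
  ...   | c , eq = c , sym eq

  -- any two vertices of M are at distance at most 2 · rad X M (through a center)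
  diam-≤ : ∀ M {u v} → T (M u) → T (M v) → dist X u v ≤ rad X M + rad X M
  diam-≤ M {u} {v} u∈M v∈M with rad-attained M
  ... | c , ecc≡rad = dist-trans (dist-sym (to-rad (ecc-≥ M c u u∈M))) (to-rad (ecc-≥ M c v v∈M))
    where
    to-rad : ∀ {d} → d ≤ ecc X M c → d ≤ rad X M
    to-rad d≤ = ≤-trans d≤ (≤-reflexive ecc≡rad)

  ecc-shift : ∀ M {x s ℓ} → dist X x s ≤ ℓ → ecc X M x ≤ ℓ + ecc X M s
  ecc-shift M {x} {s} {ℓ} d = ecc-≤ M x (ℓ + ecc X M s) (λ u u∈M → dist-trans d (ecc-≥ M s u u∈M))

∈-tabulate⁺ : ∀ {n} (Q : Fin n → Bool) {v} → T (Q v) → v ∈ tabulate Q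
∈-tabulate⁺ Q {v} q = lookup⇒[]= v (tabulate Q) (trans (lookup∘tabulate Q v) (Equivalence.to T-≡ q))

∈-tabulate⁻ : ∀ {n} (Q : Fin n → Bool) {v} → v ∈ tabulate Q → T (Q v)
∈-tabulate⁻ Q {v} m = Equivalence.from T-≡ (trans (sym (lookup∘tabulate Q v)) ([]=⇒lookup m))

-- Weak Helly property in metric form: disks D(v, r v), v ∈ Q, whose radii
-- dominate the pairwise distances pairwise intersect (graphs are geodesic),
-- so after enlarging every radius by α they have a common vertex.
weaklyHelly-dist : ∀ {α} (X : Graph) → WeaklyHelly α X → (Q : V X → Bool) (r : V X → ℕ) →
  (∀ u v → T (Q u) → T (Q v) → dist X u v ≤ r u + r v) →
  ∃ λ x → ∀ v → T (Q v) → dist X x v ≤ r v + α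
weaklyHelly-dist X wh Q r pairwise =
  map₂ (λ common v v∈Q → common v (∈-tabulate⁺ Q v∈Q)) (wh (tabulate Q) r intersect)
  where
  open Metric X
  intersect : ∀ u v → u ∈ tabulate Q → v ∈ tabulate Q → ∃ λ x → Disk X u (r u) x × Disk X v (r v) x
  intersect u v u∈Q v∈Q with dist-split (r u) (r v) (pairwise u v (∈-tabulate⁻ Q u∈Q) (∈-tabulate⁻ Q v∈Q))
  ... | x , d₁ , d₂ = x , dist-sym d₁ , d₂

rad-from-diam : ∀ {α} (X : Graph) → WeaklyHelly α X → (P : V X → Bool) (R : ℕ) →
  (∀ u v → T (P u) → T (P v) → dist X u v ≤ R + R) → rad X P ≤ R + α
rad-from-diam {α} X wh P R diam =
  let x , close = weaklyHelly-dist X wh P (λ _ → R) diam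
  in ≤-trans (rad-≤ P x) (ecc-≤ P x (R + α) close)
  where open Metric X

-- The disk family behind `centers-approximate`: for t ∈ C^k(P) and R = rad(P),
-- the disks D(m, R), m ∈ P, and D(t, k) pairwise meet (P has diameter ≤ 2R and
-- ecc(t) ≤ R + k).  A vertex carries one radius only, so if t ∈ P its disk gets
-- radius min(k, R), which is still large enough.
module DiskFamily (X : Graph) (P : V X → Bool) (k : ℕ) (t : V X) (t∈Cᵏ : Center X k P t) where
  open Metric X

  R : ℕ
  R = rad X P

  Q : V X → Bool
  Q y = P y ∨ ⌊ y ≟ t ⌋

  P⊆Q : ∀ {y} → T (P y) → T (Q y)
  P⊆Q y∈P = Equivalence.from T-∨ (inj₁ y∈P)

  t∈Q : T (Q t)
  t∈Q = Equivalence.from (T-∨ {P t}) (inj₂ (fromWitness refl))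

  Q∖t⊆P : ∀ {y} → T (Q y) → y ≢ t → T (P y)
  Q∖t⊆P {y} y∈Q y≢t with Equivalence.to (T-∨ {P y}) y∈Q
  ... | inj₁ y∈P = y∈P
  ... | inj₂ y=t = ⊥-elim (y≢t (toWitness y=t))

  capped : Bool → ℕ
  capped b = if b then k ⊓ R else k

  rₜ : ℕ
  rₜ = capped (P t)

  radius : V X → ℕ
  radius y = if ⌊ y ≟ t ⌋ then rₜ else R

  radius-t : radius t ≡ rₜ
  radius-t = cong (λ b → if b then rₜ else R) (trans (isYes≗does (t ≟ t)) (dec-true (t ≟ t) refl))

  radius-other : ∀ {y} → y ≢ t → radius y ≡ R
  radius-other {y} y≢t =
    cong (λ b → if b then rₜ else R) (trans (isYes≗does (y ≟ t)) (dec-false (y ≟ t) y≢t))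

  radius-t≤k : radius t ≤ k
  radius-t≤k = ≤-trans (≤-reflexive radius-t) (capped-≤k (P t))
    where
    capped-≤k : ∀ b → capped b ≤ k
    capped-≤k true  = m⊓n≤m k R
    capped-≤k false = ≤-refl

  radius-P : ∀ {m} → T (P m) → radius m ≤ R
  radius-P {m} = by-cases m (m ≟ t)
    where
    capped-≤R : ∀ b → T b → capped b ≤ R
    capped-≤R true _ = m⊓n≤n k R
    by-cases : ∀ m → Dec (m ≡ t) → T (P m) → radius m ≤ R
    by-cases m (yes refl) m∈P = ≤-trans (≤-reflexive radius-t) (capped-≤R (P t) m∈P)
    by-cases m (no m≢t)   _   = ≤-reflexive (radius-other m≢t)

  -- t is within rₜ + R of every vertex of P: within k + R since t ∈ C^k(P),
  -- and, when t ∈ P, within R + R since P has diameter ≤ 2R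
  t-close : ∀ {m} → T (P m) → dist X t m ≤ rₜ + R
  t-close {m} m∈P = capped-bound (P t) (λ t∈P → diam-≤ P t∈P m∈P)
    where
    via-ecc : dist X t m ≤ k + R
    via-ecc = ≤-trans (ecc-≥ P t m m∈P) (≤-trans t∈Cᵏ (≤-reflexive (+-comm R k)))
    capped-bound : ∀ b → (T b → dist X t m ≤ R + R) → dist X t m ≤ capped b + R
    capped-bound true  via-diam = subst (dist X t m ≤_) (sym (+-distribʳ-⊓ R k R)) (⊓-glb via-ecc (via-diam tt))
    capped-bound false _        = via-ecc

  pairwise : ∀ u v → T (Q u) → T (Q v) → dist X u v ≤ radius u + radius v
  pairwise u v = by-cases u v (u ≟ t) (v ≟ t)
    where
    by-cases : ∀ u v → Dec (u ≡ t) → Dec (v ≡ t) → T (Q u) → T (Q v) → dist X u v ≤ radius u + radius v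
    by-cases u v (yes refl) (yes refl) _ _ = ≤-trans dist-self z≤n
    by-cases u v (yes refl) (no v≢t) _ v∈Q rewrite radius-t | radius-other v≢t = t-close (Q∖t⊆P v∈Q v≢t)
    by-cases u v (no u≢t) (yes refl) u∈Q _ rewrite radius-t | radius-other u≢t =
      subst (dist X u t ≤_) (+-comm rₜ R) (dist-sym (t-close (Q∖t⊆P u∈Q u≢t)))
    by-cases u v (no u≢t) (no v≢t) u∈Q v∈Q rewrite radius-other u≢t | radius-other v≢t =
      diam-≤ P (Q∖t⊆P u∈Q u≢t) (Q∖t⊆P v∈Q v≢t)

-- The common vertex c of the enlarged
-- disk family is within R + α of all of P and within k + α of t.
centers-approximate : ∀ {α} (X : Graph) → WeaklyHelly α X → (P : V X → Bool) (k : ℕ) (t : V X) →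
  Center X k P t → DiskSet X (Center X α P) (k + α) t
centers-approximate {α} X wh P k t t∈Cᵏ =
  let c , close = weaklyHelly-dist X wh Q radius pairwise
  in c , ecc-≤ P c (R + α) (λ m m∈P → ≤-trans (close m (P⊆Q m∈P)) (+-monoˡ-≤ α (radius-P m∈P)))
       , dist-sym (≤-trans (close t t∈Q) (+-monoˡ-≤ α radius-t≤k))
  where
  open Metric X
  open DiskFamily X P k t t∈Cᵏ

helly-centers : (X : Graph) → Helly X → (P : V X → Bool) (k : ℕ) (t : V X) →
  Center X k P t → DiskSet X (Center X 0 P) k t
helly-centers X helly P k t t∈Cᵏ =
  let c , c∈C , d = centers-approximate X helly P k t t∈Cᵏ
  in c , c∈C , subst (dist X t c ≤_) (+-identityʳ k) d

-- In any graph, walking ℓ steps from a vertex of C^j(P) stays inside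
-- C^(j+ℓ)(P), so D(C^j(P), a + ℓ) ⊆ D(C^(j+ℓ)(P), a).
center-disk-shift : (X : Graph) (P : V X → Bool) (j a ℓ : ℕ) (y : V X) →
  DiskSet X (Center X j P) (a + ℓ) y → DiskSet X (Center X (j + ℓ) P) a y
center-disk-shift X P j a ℓ y (s , s∈Cʲ , d) =
  let x , d₁ , d₂ = dist-split a ℓ d
  in x , ≤-trans (ecc-shift P d₂) (≤-trans (+-monoʳ-≤ ℓ s∈Cʲ) (≤-reflexive shuffle)) , d₁
  where
  open Metric X
  shuffle : ℓ + (rad X P + j) ≡ rad X P + (j + ℓ)
  shuffle = trans (+-comm ℓ (rad X P + j)) (+-assoc (rad X P) j ℓ)

-- In a Helly graph D(C(P), a + ℓ) = D(C^ℓ(P), a): the inclusion ⊆ is the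
-- previous lemma, and ⊇ follows from helly-centers and the triangle inequality.
helly-center-disks : (X : Graph) → Helly X → (P : V X → Bool) (a ℓ : ℕ) (y : V X) →
  DiskSet X (Center X 0 P) (a + ℓ) y ⇔ DiskSet X (Center X ℓ P) a y
helly-center-disks X helly P a ℓ y = mk⇔ (center-disk-shift X P 0 a ℓ y) widen
  where
  widen : DiskSet X (Center X ℓ P) a y → DiskSet X (Center X 0 P) (a + ℓ) y
  widen (s , s∈Cˡ , d) =
    let c , c∈C , d′ = helly-centers X helly P ℓ s s∈Cˡ
    in c , c∈C , Metric.dist-trans X d d′

module Embedding (G H : Graph) (φ : V G → V H) (iso : IsometricEmbedding G H φ) (M : V G → Bool) where

  private
    module InG = Metric G
    module InH = Metric H

  φM : V H → Bool
  φM = imageSet G H φ M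

  image⁺ : ∀ {m} → T (M m) → T (φM (φ m))
  image⁺ {m} m∈M = any-allFin⁺ (λ u → M u ∧ ⌊ φ u ≟ φ m ⌋) m (Equivalence.from T-∧ (m∈M , fromWitness refl))

  image⁻ : ∀ {y} → T (φM y) → ∃ λ m → T (M m) × φ m ≡ y
  image⁻ y∈φM =
    let m , q = any-allFin⁻ _ y∈φM
        m∈M , φm=y = Equivalence.to T-∧ q
    in m , m∈M , toWitness φm=y

  ecc-image : ∀ v → ecc H φM (φ v) ≤ ecc G M v
  ecc-image v = InH.ecc-≤ φM (φ v) (ecc G M v) bound
    where
    bound : ∀ y → T (φM y) → dist H (φ v) y ≤ ecc G M v
    bound y y∈φM with image⁻ y∈φM
    ... | m , m∈M , refl = subst (_≤ ecc G M v) (sym (iso v m)) (InG.ecc-≥ M v m m∈M)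

  -- M has the same diameter as φ(M), at most 2 rad_H(φM), so if G is
  -- α-weakly-Helly then rad_G(M) ≤ rad_H(φM) + α
  rad-image : ∀ {α} → WeaklyHelly α G → rad G M ≤ rad H φM + α
  rad-image wh = rad-from-diam G wh M (rad H φM)
    (λ u v u∈M v∈M → subst (_≤ rad H φM + rad H φM) (iso u v) (InH.diam-≤ φM (image⁺ u∈M) (image⁺ v∈M)))

  center-image : ∀ {α ℓ v} → WeaklyHelly α G → Center G ℓ M v → Center H (α + ℓ) φM (φ v)
  center-image {α} {ℓ} {v} wh v∈Cˡ = begin
    ecc H φM (φ v)       ≤⟨ ecc-image v ⟩
    ecc G M v            ≤⟨ v∈Cˡ ⟩
    rad G M + ℓ          ≤⟨ +-monoˡ-≤ ℓ (rad-image wh) ⟩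
    rad H φM + α + ℓ     ≡⟨ +-assoc (rad H φM) α ℓ ⟩
    rad H φM + (α + ℓ)   ∎
    where open ≤-Reasoning

lemma7 : (α : ℕ) (G H : Graph) (φ : V G → V H) →
    WeaklyHelly α G → IsInjectiveHull G H φ →
    (M : V G → Bool) (ℓ : ℕ) →
    let MH : V H → Bool
        MH = λ y → imageSet G H φ M y
    in ((v : V G) → Center G ℓ M v → DiskSet H (Center H 0 MH) (α + ℓ) (φ v))
       × ((y : V H) → DiskSet H (Center H 0 MH) (α + ℓ) y ⇔ DiskSet H (Center H ℓ MH) α y)
lemma7 α G H φ wh (H-helly , φ-iso , _) M ℓ =
    (λ v v∈Cˡ → helly-centers H H-helly φM (α + ℓ) (φ v) (center-image wh v∈Cˡ))
  , helly-center-disks H H-helly φM α ℓ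
  where open Embedding G H φ φ-iso M
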